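{- A permutation $\pi$ is $\{123,312\}$-sortable if and only if $\pi$ avoids the three generalized patterns $[132$, $[42531$ and $[421\bar53$.
   Context: A permutation contains a pattern $\tau$ if it has a subsequence order-isomorphic to $\tau$. An occurrence of a generalized pattern $[\tau$ in $\pi=\pi_1\cdots\pi_n$ is an occurrence of $\tau$ that involves the first entry $\pi_1$ (necessarily as its first letter). Thus $\pi$ avoids $[132$ iff there are no $1<i<j$ with $\pi_1<\pi_j<\pi_i$, and avoids $[42531$ iff no occurrence of $42531$ begins with $\pi_1$. The permutation $\pi$ avoids $[421\bar53$ if every occurrence $\pi_1\pi_a\pi_b\pi_c$ ($1<a<b<c$) of $[4213$ extends to an occurrence $\pi_1\pi_a\pi_b\pi_d\pi_c$ of $42153$ for some $b<d<c$ (i.e. with $\pi_d>\pi_1$). For a set $T$ of patterns, a $T$-stack is a stack whose content, read top to bottom, must never contain an occurrence of a pattern of $T$; an input is processed greedily: push the next input element if this creates no forbidden occurrence in the stack, otherwise pop the top element to the output. The $T$-machine is the $T$-stack followed by a $\{21\}$-stack (classical stack, greedy); $\pi$ is $T$-sortable if the output of the $T$-machine on $\pi$ is the increasing permutation. -}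

module Defs where

open import Data.Nat using (ℕ; _<_)
open import Data.List using (List; []; _∷_; applyUpTo)
open import Data.List.Relation.Binary.Sublist.Propositional using (_⊆_)
open import Data.List.Relation.Binary.Pointwise using (Pointwise)
open import Data.List.Relation.Binary.Permutation.Propositional using (_↭_)
open import Data.List.Relation.Unary.Any using (Any)
open import Data.Product using (_×_; ∃; ∃-syntax; _,_)
open import Function.Bundles using (_⇔_)
open import Relation.Nullary using (¬_)
open import Data.Empty using (⊥)
open import Data.Unit using (⊤)

IsPerm : ℕ → List ℕ → Set
IsPerm n π = π ↭ applyUpTo Data.Nat.suc n

data OrdIso : List ℕ → List ℕ → Set where
  nil  : OrdIso [] []
  cons : ∀ {x y xs ys} →
         Pointwise (λ a b → ((x < a) ⇔ (y < b)) × ((a < x) ⇔ (b < y))) xs ys →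
         OrdIso xs ys → OrdIso (x ∷ xs) (y ∷ ys)

Contains : List ℕ → List ℕ → Set
Contains s τ = ∃[ σ ] (σ ⊆ s × OrdIso σ τ)

ContainsSome : List (List ℕ) → List ℕ → Set
ContainsSome T s = Any (Contains s) T

-- π contains the generalized pattern [τ : an occurrence of τ involving π₁.
ContainsFirst : List ℕ → List ℕ → Set
ContainsFirst []      τ = ⊥
ContainsFirst (p ∷ r) τ = ∃[ σ ] (σ ⊆ r × OrdIso (p ∷ σ) τ)

AvoidsFirst : List ℕ → List ℕ → Set
AvoidsFirst π τ = ¬ ContainsFirst π τ

-- π avoids [421̄53: every occurrence π₁ a b c of [4213 extends to an
-- occurrence π₁ a b d c of 42153 (d lying between b and c in π).
Avoids[421b53 : List ℕ → Set
Avoids[421b53 []      = ⊤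
Avoids[421b53 (p ∷ r) =
  ∀ a b c → (a ∷ b ∷ c ∷ []) ⊆ r → OrdIso (p ∷ a ∷ b ∷ c ∷ []) (4 ∷ 2 ∷ 1 ∷ 3 ∷ []) →
  ∃[ d ] ((a ∷ b ∷ d ∷ c ∷ []) ⊆ r × OrdIso (p ∷ a ∷ b ∷ d ∷ c ∷ []) (4 ∷ 2 ∷ 1 ∷ 5 ∷ 3 ∷ []))

-- Greedy run of a T-stack (content read top to bottom, stored as a list with the top first).
-- RunStack T input stack output : processing `input` starting from `stack` produces `output`.
data RunStack (T : List (List ℕ)) : List ℕ → List ℕ → List ℕ → Set where
  done : ∀ {st} → RunStack T [] st st
  push : ∀ {x xs st out} → ¬ ContainsSome T (x ∷ st) →
         RunStack T xs (x ∷ st) out → RunStack T (x ∷ xs) st out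
  pop  : ∀ {x xs y st out} → ContainsSome T (x ∷ y ∷ st) →
         RunStack T (x ∷ xs) st out → RunStack T (x ∷ xs) (y ∷ st) (y ∷ out)

TMachine : List (List ℕ) → List ℕ → List ℕ → Set
TMachine T π out = ∃[ mid ] (RunStack T π [] mid × RunStack ((2 ∷ 1 ∷ []) ∷ []) mid [] out)

Sortable : List (List ℕ) → ℕ → List ℕ → Set
Sortable T n π = TMachine T π (applyUpTo Data.Nat.suc n)

T123-312 : List (List ℕ)
T123-312 = (1 ∷ 2 ∷ 3 ∷ []) ∷ (3 ∷ 1 ∷ 2 ∷ []) ∷ []

module Submission where

-- Let p = π₁; it is pushed first and stays at the bottom of the {123,312}-stack. As long as the
-- input read so far avoids [132, the stack is a decreasing run S of entries below p on top of a
-- decreasing run D of entries above p ending in p. An entry x < p pops exactly the entries of S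
-- above x (each forms a 123 with x and p) and is pushed; an entry x > p pops all of S (each forms
-- a 312 with x and p) and is pushed onto D. The classical stack sorts its input iff the input
-- avoids 231, so it remains to relate 231s in the intermediate output to the three patterns: a
-- [132 leaves c b p, a [42531 p a B c d leaves a c d, and a [4213 p a b c with no entry above p
-- between b and c keeps some entry ≤ b on the stack until c arrives, leaving a c m. Conversely,
-- when π avoids the three patterns, every entry popped by a smaller one is never straddled by a
-- later 21 of the output, which makes the whole output 231-free.

open import Defs
import Relation.Binary.PropositionalEquality as PE
open import Data.Nat using (ℕ; zero; suc; _<_; _>_; _≤_; _≤?_; _<?_; s≤s)
open import Data.Nat.Properties
open import Data.List using (List; _∷_; []; _++_; applyUpTo)
open import Data.List.Properties using (++-assoc; ++-identityʳ)
open import Data.List.Membership.Propositional using (_∈_; _∉_; find)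
open import Data.List.Membership.Propositional.Properties using (∈-++⁺ˡ; ∈-++⁺ʳ; ∈-++⁻)
open import Data.List.Relation.Binary.Sublist.Propositional {A = ℕ}
  using (_⊆_; []; _∷_; _∷ʳ_; minimum; ⊆-refl; ⊆-trans; to∈; from∈)
open import Data.List.Relation.Binary.Sublist.Propositional.Properties using (∷ˡ⁻; ++⁺ˡ)
open import Data.List.Relation.Binary.Pointwise using ([]; _∷_; Pointwise-≡⇒≡)
open import Data.List.Relation.Binary.Permutation.Propositional
  using (_↭_; ↭-refl; ↭-sym; ↭-trans; prep; ↭⇒↭ₛ; ↭-reflexive)
open import Data.List.Relation.Binary.Permutation.Propositional.Properties using (shift; ∈-resp-↭; ↭-length)
open import Data.List.Relation.Binary.Permutation.Setoid.Properties (PE.setoid ℕ) using (Unique-resp-↭)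
open import Data.List.Relation.Unary.Any using (Any; here; there)
import Data.List.Relation.Unary.Any as Any
open import Data.List.Relation.Unary.All using (All; []; _∷_)
import Data.List.Relation.Unary.All as All
import Data.List.Relation.Unary.All.Properties as All
open import Data.List.Relation.Unary.AllPairs using (AllPairs; []; _∷_)
import Data.List.Relation.Unary.AllPairs as AllPairs
import Data.List.Relation.Unary.AllPairs.Properties as AllPairs
open import Data.List.Relation.Unary.Linked.Properties using (AllPairs⇒Linked)
open import Data.List.Relation.Unary.Sorted.TotalOrder.Properties using (↗↭↗⇒≋)
open import Data.List.Relation.Unary.Unique.Propositional using (Unique)
open import Data.List.Relation.Unary.Unique.Propositional.Properties using (Unique[x∷xs]⇒x∉xs)
import Data.List.Relation.Unary.Unique.Propositional.Properties as Unique
open import Data.Product using (_×_; _,_; proj₁; proj₂; ∃)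
open import Data.Sum using (_⊎_; inj₁; inj₂)
open import Data.Empty using (⊥; ⊥-elim)
open import Data.Unit using (⊤; tt)
open import Function.Bundles using (_⇔_; mk⇔; Equivalence)
open import Relation.Nullary using (¬_; yes; no)
open import Relation.Nullary.Decidable using (True; toWitness)
open import Relation.Binary.PropositionalEquality using (_≡_; _≢_; refl; sym; cong; subst)
open import Relation.Binary.Definitions using (tri<; tri≈; tri>)

lit : ∀ {i j : ℕ} {t : True (i <? j)} → i < j
lit {t = t} = toWitness t

≢⇒<⊎> : ∀ {x y : ℕ} → x ≢ y → x < y ⊎ y < x
≢⇒<⊎> {x} {y} x≢y with <-cmp x y
... | tri< x<y _ _ = inj₁ x<y
... | tri≈ _ x≡y _ = ⊥-elim (x≢y x≡y)
... | tri> _ _ y<x = inj₂ y<x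

SameOrder : ℕ → ℕ → ℕ → ℕ → Set
SameOrder x a y b = ((x < a) ⇔ (y < b)) × ((a < x) ⇔ (b < y))

both< : ∀ {x a y b} → x < a → y < b → SameOrder x a y b
both< xa yb = mk⇔ (λ _ → yb) (λ _ → xa) , mk⇔ (λ ax → ⊥-elim (<-asym xa ax)) (λ by → ⊥-elim (<-asym yb by))

both> : ∀ {x a y b} → a < x → b < y → SameOrder x a y b
both> ax by = mk⇔ (λ xa → ⊥-elim (<-asym ax xa)) (λ yb → ⊥-elim (<-asym by yb)) , mk⇔ (λ _ → by) (λ _ → ax)

reflect< : ∀ {x a y b} → SameOrder x a y b → y < b → x < a
reflect< e = Equivalence.from (proj₁ e)

reflect> : ∀ {x a y b} → SameOrder x a y b → b < y → a < x
reflect> e = Equivalence.from (proj₂ e)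

iso21 : ∀ {a b} → b < a → OrdIso (a ∷ b ∷ []) (2 ∷ 1 ∷ [])
iso21 ba = cons (both> ba lit ∷ []) (cons [] nil)

iso123 : ∀ {a b c} → a < b → b < c → OrdIso (a ∷ b ∷ c ∷ []) (1 ∷ 2 ∷ 3 ∷ [])
iso123 ab bc = cons (both< ab lit ∷ both< (<-trans ab bc) lit ∷ []) (cons (both< bc lit ∷ []) (cons [] nil))

iso312 : ∀ {a b c} → b < c → c < a → OrdIso (a ∷ b ∷ c ∷ []) (3 ∷ 1 ∷ 2 ∷ [])
iso312 bc ca = cons (both> (<-trans bc ca) lit ∷ both> ca lit ∷ []) (cons (both< bc lit ∷ []) (cons [] nil))

iso132 : ∀ {p b c} → p < c → c < b → OrdIso (p ∷ b ∷ c ∷ []) (1 ∷ 3 ∷ 2 ∷ [])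
iso132 pc cb = cons (both< (<-trans pc cb) lit ∷ both< pc lit ∷ []) (cons (both> cb lit ∷ []) (cons [] nil))

iso42531 : ∀ {p a B c d} → d < a → a < c → c < p → p < B → OrdIso (p ∷ a ∷ B ∷ c ∷ d ∷ []) (4 ∷ 2 ∷ 5 ∷ 3 ∷ 1 ∷ [])
iso42531 da ac cp pB =
  let ap = <-trans ac cp ; dp = <-trans da ap ; cB = <-trans cp pB ; aB = <-trans ac cB ; dB = <-trans da aB ; dc = <-trans da ac in
  cons (both> ap lit ∷ both< pB lit ∷ both> cp lit ∷ both> dp lit ∷ [])
   (cons (both< aB lit ∷ both< ac lit ∷ both> da lit ∷ [])
    (cons (both> cB lit ∷ both> dB lit ∷ [])
     (cons (both> dc lit ∷ []) (cons [] nil))))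

iso4213 : ∀ {p a b c} → b < a → a < c → c < p → OrdIso (p ∷ a ∷ b ∷ c ∷ []) (4 ∷ 2 ∷ 1 ∷ 3 ∷ [])
iso4213 ba ac cp =
  let ap = <-trans ac cp ; bp = <-trans ba ap ; bc = <-trans ba ac in
  cons (both> ap lit ∷ both> bp lit ∷ both> cp lit ∷ [])
   (cons (both> ba lit ∷ both< ac lit ∷ [])
    (cons (both< bc lit ∷ []) (cons [] nil)))

iso42153 : ∀ {p a b c d} → b < a → a < c → c < p → p < d → OrdIso (p ∷ a ∷ b ∷ d ∷ c ∷ []) (4 ∷ 2 ∷ 1 ∷ 5 ∷ 3 ∷ [])
iso42153 ba ac cp pd =
  let ap = <-trans ac cp ; bp = <-trans ba ap ; bc = <-trans ba ac ; cd = <-trans cp pd ; ad = <-trans ac cd ; bd = <-trans ba ad in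
  cons (both> ap lit ∷ both> bp lit ∷ both< pd lit ∷ both> cp lit ∷ [])
   (cons (both> ba lit ∷ both< ad lit ∷ both< ac lit ∷ [])
    (cons (both< bd lit ∷ both< bc lit ∷ [])
     (cons (both> cd lit ∷ []) (cons [] nil))))

∉-tail : ∀ {x y : ℕ} {ys} → x ∉ (y ∷ ys) → x ∉ ys
∉-tail x∉ i = x∉ (there i)

∈-∷-⊆-++ : ∀ {x ys} (P : List ℕ) {O} → x ∈ P → ys ⊆ O → (x ∷ ys) ⊆ P ++ O
∈-∷-⊆-++ (q ∷ P) (here refl) s = refl ∷ ++⁺ˡ P s
∈-∷-⊆-++ (q ∷ P) (there i) s = q ∷ʳ ∈-∷-⊆-++ P i s

⊆-skip-smaller : ∀ {x xs B rest} → x < B → (B ∷ rest) ⊆ x ∷ xs → (B ∷ rest) ⊆ xs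
⊆-skip-smaller x<B (_ ∷ʳ s) = s
⊆-skip-smaller x<B (refl ∷ s) = ⊥-elim (<-irrefl refl x<B)

⊆-init : ∀ {a b c L} → (a ∷ b ∷ c ∷ []) ⊆ L → (a ∷ b ∷ []) ⊆ L
⊆-init s = ⊆-trans (refl ∷ refl ∷ _ ∷ʳ []) s

pair-split : ∀ {b c} (S : List ℕ) {D} → (b ∷ c ∷ []) ⊆ S ++ D →
  ((b ∷ c ∷ []) ⊆ S) ⊎ ((b ∈ S × c ∈ D) ⊎ ((b ∷ c ∷ []) ⊆ D))
pair-split [] s = inj₂ (inj₂ s)
pair-split (x ∷ S) (.x ∷ʳ s) with pair-split S s
... | inj₁ q = inj₁ (x ∷ʳ q)
... | inj₂ (inj₁ (i , j)) = inj₂ (inj₁ (there i , j))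
... | inj₂ (inj₂ q) = inj₂ (inj₂ q)
pair-split (x ∷ S) (refl ∷ s) with ∈-++⁻ S (to∈ s)
... | inj₁ k = inj₁ (refl ∷ from∈ k)
... | inj₂ k = inj₂ (inj₁ (here refl , k))

triple-split : ∀ {y z w} (P : List ℕ) {O} → (y ∷ z ∷ w ∷ []) ⊆ P ++ O →
  ((y ∷ z ∷ []) ⊆ P) ⊎ ((y ∈ P × (z ∷ w ∷ []) ⊆ O) ⊎ ((y ∷ z ∷ w ∷ []) ⊆ O))
triple-split [] s = inj₂ (inj₂ s)
triple-split (q ∷ P) (_ ∷ʳ s) with triple-split P s
... | inj₁ a = inj₁ (q ∷ʳ a)
... | inj₂ (inj₁ (i , a)) = inj₂ (inj₁ (there i , a))
... | inj₂ (inj₂ a) = inj₂ (inj₂ a)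
triple-split (q ∷ P) (refl ∷ s) with pair-split P s
... | inj₁ a = inj₁ (refl ∷ from∈ (to∈ a))
... | inj₂ (inj₁ (i , j)) = inj₁ (refl ∷ from∈ i)
... | inj₂ (inj₂ a) = inj₂ (inj₁ (here refl , a))

⊆-split : ∀ {x xs L} → (x ∷ xs) ⊆ L → ∃ λ α → ∃ λ L' → L ≡ α ++ x ∷ L' × xs ⊆ L'
⊆-split (y ∷ʳ s) with ⊆-split s
... | α , L' , refl , s' = y ∷ α , L' , refl , s'
⊆-split (refl ∷ s) = [] , _ , refl , s

⊆-after-unique : ∀ (α : List ℕ) {x ys L} → x ∉ α → x ∉ L → (x ∷ ys) ⊆ α ++ x ∷ L → ys ⊆ L
⊆-after-unique [] x∉α x∉L (refl ∷ s) = s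
⊆-after-unique [] x∉α x∉L (_ ∷ʳ s) = ⊥-elim (x∉L (to∈ s))
⊆-after-unique (a ∷ α) x∉α x∉L (refl ∷ s) = ⊥-elim (x∉α (here refl))
⊆-after-unique (a ∷ α) x∉α x∉L (_ ∷ʳ s) = ⊆-after-unique α (λ i → x∉α (there i)) x∉L s

∉∧¬>⇒All< : ∀ {q xs} → q ∉ xs → ¬ Any (q <_) xs → All (_< q) xs
∉∧¬>⇒All< {q} {xs} q∉ q≮ = All.tabulate below
  where
  below : ∀ {e} → e ∈ xs → e < q
  below {e} e∈ with ≢⇒<⊎> (λ e≡q → q∉ (subst (_∈ xs) e≡q e∈))
  ... | inj₁ e<q = e<q
  ... | inj₂ q<e = ⊥-elim (q≮ (Any.map (λ e≡y → subst (q <_) e≡y q<e) e∈))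

AllPairs-pair : ∀ {R : ℕ → ℕ → Set} {L a b} → AllPairs R L → (a ∷ b ∷ []) ⊆ L → R a b
AllPairs-pair (px ∷ pxs) (_ ∷ʳ s) = AllPairs-pair pxs s
AllPairs-pair (px ∷ pxs) (refl ∷ s) = All.lookup px (to∈ s)

AllPairs-++⁻ˡ : ∀ {R : ℕ → ℕ → Set} (P : List ℕ) {S} → AllPairs R (P ++ S) → AllPairs R P
AllPairs-++⁻ˡ [] a = []
AllPairs-++⁻ˡ (q ∷ P) (x ∷ a) = All.++⁻ˡ P x ∷ AllPairs-++⁻ˡ P a

AllPairs-++⁻ʳ : ∀ {R : ℕ → ℕ → Set} (P : List ℕ) {S} → AllPairs R (P ++ S) → AllPairs R S
AllPairs-++⁻ʳ [] a = a
AllPairs-++⁻ʳ (q ∷ P) (_ ∷ a) = AllPairs-++⁻ʳ P a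

Unique-++⁻ʳ : ∀ (α : List ℕ) {L} → Unique (α ++ L) → Unique L
Unique-++⁻ʳ [] u = u
Unique-++⁻ʳ (a ∷ α) (_ ∷ u) = Unique-++⁻ʳ α u

Unique-middle : ∀ (α : List ℕ) {x L} → Unique (α ++ x ∷ L) → x ∉ α × x ∉ L
Unique-middle [] u = (λ ()) , Unique[x∷xs]⇒x∉xs u
Unique-middle (a ∷ α) {x} {L} (ha ∷ u) with Unique-middle α u
... | n1 , n2 = (λ { (here e) → All.lookup ha (∈-++⁺ʳ α (here refl)) (sym e) ; (there i) → n1 i }) , n2

IsPerm⇒Unique : ∀ {n π} → IsPerm n π → Unique π
IsPerm⇒Unique {n} perm = Unique-resp-↭ (↭⇒↭ₛ (↭-sym perm)) (Unique.applyUpTo⁺₁ suc n (λ i<j _ → <⇒≢ (s≤s i<j)))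

upTo-increasing : ∀ n → AllPairs _<_ (applyUpTo suc n)
upTo-increasing n = AllPairs.applyUpTo⁺₁ suc n (λ i<j _ → s≤s i<j)

sorted↭upTo⇒≡ : ∀ {o n} → AllPairs _≤_ o → o ↭ applyUpTo suc n → o ≡ applyUpTo suc n
sorted↭upTo⇒≡ {o} {n} so perm = Pointwise-≡⇒≡ (↗↭↗⇒≋ ≤-totalOrder (AllPairs⇒Linked so)
  (AllPairs⇒Linked (AllPairs.map <⇒≤ (upTo-increasing n))) (↭⇒↭ₛ perm))

push-forced : ∀ {T x xs st out} → ¬ ContainsSome T (x ∷ st) → RunStack T (x ∷ xs) st out → RunStack T xs (x ∷ st) out
push-forced nc (push _ R) = R
push-forced nc (pop c _) = ⊥-elim (nc c)

pop-forced : ∀ {T x xs y st out} → ContainsSome T (x ∷ y ∷ st) → RunStack T (x ∷ xs) (y ∷ st) out →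
  ∃ λ out' → out ≡ y ∷ out' × RunStack T (x ∷ xs) st out'
pop-forced c (push nc _) = ⊥-elim (nc c)
pop-forced c (pop _ R) = _ , refl , R

stack⊆output : ∀ {T inp st out} → RunStack T inp st out → st ⊆ out
stack⊆output done = ⊆-refl
stack⊆output (push _ R) = ∷ˡ⁻ (stack⊆output R)
stack⊆output (pop _ R) = refl ∷ stack⊆output R

output↭ : ∀ {T inp st out} → RunStack T inp st out → out ↭ inp ++ st
output↭ done = ↭-refl
output↭ (push {x} {xs} {st} _ R) = ↭-trans (output↭ R) (shift x xs st)
output↭ (pop {x} {xs} {y} {st} _ R) = ↭-trans (prep y (output↭ R)) (↭-sym (shift y (x ∷ xs) st))

∈-output : ∀ {T inp st out e} → RunStack T inp st out → e ∈ inp ++ st → e ∈ out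
∈-output R i = ∈-resp-↭ (↭-sym (output↭ R)) i

∈-output-pushed : ∀ {T x xs st out e} → RunStack T xs (x ∷ st) out → e ∈ x ∷ xs → e ∈ out
∈-output-pushed {xs = xs} R (here refl) = ∈-output R (∈-++⁺ʳ xs (here refl))
∈-output-pushed R (there i) = ∈-output R (∈-++⁺ˡ i)

output-∈ : ∀ {T inp st out e} → RunStack T inp st out → e ∈ out → e ∈ inp ++ st
output-∈ R i = ∈-resp-↭ (output↭ R) i

T21 : List (List ℕ)
T21 = (2 ∷ 1 ∷ []) ∷ []

contains21 : ∀ {a b L} → (a ∷ b ∷ []) ⊆ L → b < a → ContainsSome T21 L
contains21 s ba = here (_ , s , iso21 ba)

sorted⇒¬contains21 : ∀ {L} → AllPairs _≤_ L → ¬ ContainsSome T21 L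
sorted⇒¬contains21 sd (here (_ , s , cons (e ∷ []) _)) = <⇒≱ (reflect> e lit) (AllPairs-pair sd s)
sorted⇒¬contains21 sd (there ())

stacked-precedes-after-larger : ∀ {inp st out a b c} → RunStack T21 inp st out →
  b ∈ st → (c ∷ a ∷ []) ⊆ inp → b < c → (b ∷ a ∷ []) ⊆ out
stacked-precedes-after-larger done bS () bc
stacked-precedes-after-larger (push nc R) bS (refl ∷ s) bc = ⊥-elim (nc (contains21 (refl ∷ from∈ bS) bc))
stacked-precedes-after-larger (push nc R) bS (_ ∷ʳ s) bc = stacked-precedes-after-larger R (there bS) s bc
stacked-precedes-after-larger (pop _ R) (here refl) s bc = refl ∷ from∈ (∈-output R (∈-++⁺ˡ (to∈ (∷ˡ⁻ s))))
stacked-precedes-after-larger (pop _ R) (there bS) s bc = _ ∷ʳ stacked-precedes-after-larger R bS s bc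

precedes-after-larger : ∀ {inp st out a b c} → RunStack T21 inp st out →
  (b ∷ c ∷ a ∷ []) ⊆ inp → b < c → (b ∷ a ∷ []) ⊆ out
precedes-after-larger done () bc
precedes-after-larger (push nc R) (refl ∷ s) bc = stacked-precedes-after-larger R (here refl) s bc
precedes-after-larger (push nc R) (_ ∷ʳ s) bc = precedes-after-larger R s bc
precedes-after-larger (pop _ R) s bc = _ ∷ʳ precedes-after-larger R s bc

Avoids231 : List ℕ → Set
Avoids231 out = ∀ {y z w} → (y ∷ z ∷ w ∷ []) ⊆ out → y < z → w < y → ⊥

sortable⇒avoids231 : ∀ {mid n} → RunStack T21 mid [] (applyUpTo suc n) → Avoids231 mid
sortable⇒avoids231 {n = n} R s yz wy = <-asym wy (AllPairs-pair (upTo-increasing n) (precedes-after-larger R s yz))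

-- Once a later entry exceeds a stacked y, no smaller entry may follow: otherwise y would have to
-- leave the stack before it.
Settled : List ℕ → List ℕ → Set
Settled st inp = ∀ {y x z} → y ∈ st → (x ∷ z ∷ []) ⊆ inp → y < x → y ≤ z

record SortedRun (inp st : List ℕ) : Set where
  constructor sortedRun
  field
    out : List ℕ
    run : RunStack T21 inp st out
    sorted : AllPairs _≤_ out

settled-push : ∀ {x xs st} → Settled st (x ∷ xs) → Avoids231 (x ∷ xs) → Settled (x ∷ st) xs
settled-push settled av (here refl) s yx = ≮⇒≥ (λ zy → av (refl ∷ s) yx zy)
settled-push settled av (there i) s yx = settled i (_ ∷ʳ s) yx

popped≤output : ∀ {x xs y st o} → All (y ≤_) st → Settled (y ∷ st) (x ∷ xs) → y < x →
  RunStack T21 (x ∷ xs) st o → All (y ≤_) o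
popped≤output {x} {xs} y≤st settled y<x R = All.tabulate λ eo → bound (∈-++⁻ (x ∷ xs) (output-∈ R eo))
  where
  bound : ∀ {e} → e ∈ x ∷ xs ⊎ e ∈ _ → _ ≤ e
  bound (inj₁ (here refl)) = <⇒≤ y<x
  bound (inj₁ (there eI)) = settled (here refl) (refl ∷ from∈ eI) y<x
  bound (inj₂ eS) = All.lookup y≤st eS

mutual
  sort-231-free : ∀ inp st → AllPairs _≤_ st → Settled st inp → Avoids231 inp → SortedRun inp st
  sort-231-free [] st sd settled av = sortedRun st done sd
  sort-231-free (x ∷ xs) st sd settled av = sort-231-free-∷ x xs st sd settled av

  sort-231-free-∷ : ∀ x xs st → AllPairs _≤_ st → Settled st (x ∷ xs) → Avoids231 (x ∷ xs) → SortedRun (x ∷ xs) st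
  sort-231-free-∷ x xs [] sd settled av =
    let r = sort-231-free xs (x ∷ []) ([] ∷ []) (settled-push settled av) (λ s → av (_ ∷ʳ s))
    in sortedRun (SortedRun.out r) (push (sorted⇒¬contains21 ([] ∷ [])) (SortedRun.run r)) (SortedRun.sorted r)
  sort-231-free-∷ x xs (y ∷ st) (y≤st ∷ sd) settled av with x ≤? y
  ... | yes x≤y =
    let sd' = (x≤y ∷ All.map (≤-trans x≤y) y≤st) ∷ y≤st ∷ sd
        r = sort-231-free xs (x ∷ y ∷ st) sd' (settled-push settled av) (λ s → av (_ ∷ʳ s))
    in sortedRun (SortedRun.out r) (push (sorted⇒¬contains21 sd') (SortedRun.run r)) (SortedRun.sorted r)
  ... | no x≰y =
    let r = sort-231-free-∷ x xs st sd (λ i → settled (there i)) av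
        y<x = ≰⇒> x≰y
    in sortedRun (y ∷ SortedRun.out r) (pop (contains21 (refl ∷ refl ∷ minimum st) y<x) (SortedRun.run r))
         (popped≤output y≤st settled y<x (SortedRun.run r) ∷ SortedRun.sorted r)

avoids231⇒sortable : ∀ {n mid} → mid ↭ applyUpTo suc n → Avoids231 mid → RunStack T21 mid [] (applyUpTo suc n)
avoids231⇒sortable {n} {mid} mid↭ av = subst (RunStack T21 mid []) (sorted↭upTo⇒≡ (SortedRun.sorted K) out↭) (SortedRun.run K)
  where
  K : SortedRun mid []
  K = sort-231-free mid [] [] (λ ()) av
  out↭ : SortedRun.out K ↭ applyUpTo suc n
  out↭ = ↭-trans (output↭ (SortedRun.run K)) (↭-trans (↭-reflexive (++-identityʳ mid)) mid↭)

No123-312 : List ℕ → Set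
No123-312 L = ∀ {a b c} → (a ∷ b ∷ c ∷ []) ⊆ L → (a < b → b < c → ⊥) × (b < c → c < a → ⊥)

No123-312⇒¬contains : ∀ {L} → No123-312 L → ¬ ContainsSome T123-312 L
No123-312⇒¬contains np (here (_ , s , cons (e1 ∷ e2 ∷ []) (cons (e3 ∷ []) _))) = proj₁ (np s) (reflect< e1 lit) (reflect< e3 lit)
No123-312⇒¬contains np (there (here (_ , s , cons (e1 ∷ e2 ∷ []) (cons (e3 ∷ []) _)))) = proj₂ (np s) (reflect< e3 lit) (reflect> e2 lit)
No123-312⇒¬contains np (there (there ()))

No123-312-∷ : ∀ {x M} → No123-312 M → (∀ {b c} → (b ∷ c ∷ []) ⊆ M → b < c → ¬ (x < b) × ¬ (c < x)) → No123-312 (x ∷ M)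
No123-312-∷ np h (_ ∷ʳ s) = np s
No123-312-∷ np h (refl ∷ s) = (λ xb bc → proj₁ (h s bc) xb) , (λ bc cx → proj₂ (h s bc) cx)

decreasing⇒No123-312 : ∀ {L} → AllPairs _>_ L → No123-312 L
decreasing⇒No123-312 ap s = (λ ab _ → <-asym ab (AllPairs-pair ap (⊆-init s))) , (λ bc _ → <-asym bc (AllPairs-pair ap (∷ˡ⁻ s)))

No123-312-[x] : ∀ {x} → No123-312 (x ∷ [])
No123-312-[x] (_ ∷ʳ ())
No123-312-[x] (refl ∷ ())

contains123 : ∀ {a b c L} → (a ∷ b ∷ c ∷ []) ⊆ L → a < b → b < c → ContainsSome T123-312 L
contains123 s ab bc = here (_ , s , iso123 ab bc)

contains312 : ∀ {a b c L} → (a ∷ b ∷ c ∷ []) ⊆ L → b < c → c < a → ContainsSome T123-312 L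
contains312 s bc ca = there (here (_ , s , iso312 bc ca))

module FirstEntry (p : ℕ) where

  No[132 : List ℕ → Set
  No[132 L = ∀ {b c} → (b ∷ c ∷ []) ⊆ L → p < c → c < b → ⊥

  DBelowLarge : List ℕ → List ℕ → Set
  DBelowLarge inp D = ∀ {b c} → b ∈ D → c ∈ inp → p < c → b < c

  -- The stack, read top to bottom, is S ++ D; inp is the remaining input.
  record Layout (inp S D : List ℕ) : Set where
    constructor layout
    field
      S↘ : AllPairs _>_ S
      S<p : All (_< p) S
      D↘ : AllPairs _>_ D
      p≤D : All (p ≤_) D
      p∈D : p ∈ D
      input-unique : Unique inp
      S-fresh : All (_∉ inp) S
      D-fresh : All (_∉ inp) D
  open Layout public

  record Invariant (inp S D : List ℕ) : Set where
    constructor invariant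
    field
      shape : Layout inp S D
      no[132 : No[132 inp
      D<later-large : DBelowLarge inp D
  open Invariant public

  layout-No123-312 : ∀ {S D} → AllPairs _>_ S → All (_< p) S → AllPairs _>_ D → All (p ≤_) D → No123-312 (S ++ D)
  layout-No123-312 {[]} _ _ D↘ _ = decreasing⇒No123-312 D↘
  layout-No123-312 {s ∷ S} {D} (s>S ∷ S↘) (s<p ∷ S<p) D↘ p≤D = No123-312-∷ (layout-No123-312 S↘ S<p D↘ p≤D) no-pair
    where
    no-pair : ∀ {b c} → (b ∷ c ∷ []) ⊆ S ++ D → b < c → ¬ (s < b) × ¬ (c < s)
    no-pair sub bc with pair-split S sub
    ... | inj₁ q = ⊥-elim (<-asym bc (AllPairs-pair S↘ q))
    ... | inj₂ (inj₁ (i , j)) = (λ sb → <-asym sb (All.lookup s>S i)) , (λ cs → <⇒≱ (<-trans cs s<p) (All.lookup p≤D j))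
    ... | inj₂ (inj₂ q) = ⊥-elim (<-asym bc (AllPairs-pair D↘ q))

  head∉S : ∀ {x xs S D} → Layout (x ∷ xs) S D → x ∉ S
  head∉S g i = All.lookup (S-fresh g) i (here refl)

  small⊎large : ∀ {x xs S D} → Layout (x ∷ xs) S D → x < p ⊎ p < x
  small⊎large g = ≢⇒<⊎> (λ e → All.lookup (D-fresh g) (p∈D g) (here (sym e)))

  layout-small : ∀ {x xs S' D} (P : List ℕ) → Layout (x ∷ xs) (P ++ S') D → x < p → All (_< x) S' → Layout xs (x ∷ S') D
  layout-small P g xp sx =
    layout (sx ∷ AllPairs-++⁻ʳ P (S↘ g)) (xp ∷ All.++⁻ʳ P (S<p g)) (D↘ g) (p≤D g) (p∈D g) (AllPairs.tail (input-unique g))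
      (Unique[x∷xs]⇒x∉xs (input-unique g) ∷ All.map ∉-tail (All.++⁻ʳ P (S-fresh g))) (All.map ∉-tail (D-fresh g))

  layout-large : ∀ {x xs S D} → Layout (x ∷ xs) S D → p < x → All (_< x) D → Layout xs [] (x ∷ D)
  layout-large g px dx =
    layout [] [] (dx ∷ D↘ g) (<⇒≤ px ∷ p≤D g) (there (p∈D g)) (AllPairs.tail (input-unique g)) []
      (Unique[x∷xs]⇒x∉xs (input-unique g) ∷ All.map ∉-tail (D-fresh g))

  D<large : ∀ {x xs S D} → Invariant (x ∷ xs) S D → p < x → All (_< x) D
  D<large I px = All.tabulate (λ bD → D<later-large I bD (here refl) px)

  invariant-small : ∀ {x xs S S' D} → Invariant (x ∷ xs) S D → Layout xs S' D → Invariant xs S' D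
  invariant-small I g' = invariant g' (λ s → no[132 I (_ ∷ʳ s)) (λ bD cI → D<later-large I bD (there cI))

  invariant-large : ∀ {x xs S D} → Invariant (x ∷ xs) S D → p < x → Invariant xs [] (x ∷ D)
  invariant-large {x} I px = invariant (layout-large (shape I) px (D<large I px)) (λ s → no[132 I (_ ∷ʳ s)) x<later-large
    where
    x<later-large : DBelowLarge _ (x ∷ _)
    x<later-large (here refl) cI pc with ≢⇒<⊎> (λ x≡c → Unique[x∷xs]⇒x∉xs (input-unique (shape I)) (subst (_∈ _) (sym x≡c) cI))
    ... | inj₁ x<c = x<c
    ... | inj₂ c<x = ⊥-elim (no[132 I (refl ∷ from∈ cI) pc c<x)
    x<later-large (there bD) cI pc = D<later-large I bD (there cI) pc

  -- When x is read, each stacked entry q with Triggers x q is popped: with p further down, x q p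
  -- is a 123 or a 312.
  Triggers : ℕ → ℕ → Set
  Triggers x q = (x < q × q < p) ⊎ (q < p × p < x)

  triggers⇒contains : ∀ {x q L} → p ∈ L → Triggers x q → ContainsSome T123-312 (x ∷ q ∷ L)
  triggers⇒contains p∈L (inj₁ (xq , qp)) = contains123 (refl ∷ refl ∷ from∈ p∈L) xq qp
  triggers⇒contains p∈L (inj₂ (qp , px)) = contains312 (refl ∷ refl ∷ from∈ p∈L) qp px

  pops : ∀ {x xs st out'} (P : List ℕ) → All (Triggers x) P → p ∈ st →
    RunStack T123-312 (x ∷ xs) st out' → RunStack T123-312 (x ∷ xs) (P ++ st) (P ++ out')
  pops [] _ _ R = R
  pops (q ∷ P) (t ∷ ts) p∈st R = pop (triggers⇒contains (∈-++⁺ʳ P p∈st) t) (pops P ts p∈st R)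

  pops-forced : ∀ {x xs st out} (P : List ℕ) → All (Triggers x) P → p ∈ st →
    RunStack T123-312 (x ∷ xs) (P ++ st) out → ∃ λ out' → out ≡ P ++ out' × RunStack T123-312 (x ∷ xs) st out'
  pops-forced [] _ _ R = _ , refl , R
  pops-forced (q ∷ P) (t ∷ ts) p∈st R with pop-forced (triggers⇒contains (∈-++⁺ʳ P p∈st) t) R
  ... | _ , refl , R₁ with pops-forced P ts p∈st R₁
  ...   | out' , refl , R' = out' , refl , R'

  record Split (x : ℕ) (S : List ℕ) : Set where
    constructor splitting
    field
      P S' : List ℕ
      S≡ : S ≡ P ++ S'
      x<P : All (x <_) P
      S'<x : All (_< x) S'

  split-around : ∀ x S → AllPairs _>_ S → x ∉ S → Split x S
  split-around x [] _ _ = splitting [] [] refl [] []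
  split-around x (s ∷ S) (s>S ∷ S↘) x∉ with x <? s
  ... | yes x<s with split-around x S S↘ (∉-tail x∉)
  ...   | splitting P S' refl x<P S'<x = splitting (s ∷ P) S' refl (x<s ∷ x<P) S'<x
  split-around x (s ∷ S) (s>S ∷ S↘) x∉ | no x≮s = splitting [] (s ∷ S) refl [] (s<x ∷ All.map (λ y<s → <-trans y<s s<x) s>S)
    where
    s<x : s < x
    s<x with ≢⇒<⊎> (λ s≡x → x∉ (here (sym s≡x)))
    ... | inj₁ s<x = s<x
    ... | inj₂ x<s = ⊥-elim (x≮s x<s)

  small-triggers : ∀ {x} P → All (x <_) P → All (_< p) P → All (Triggers x) P
  small-triggers P x<P P<p = All.map inj₁ (All.zip (x<P , P<p))

  large-triggers : ∀ {x S} → p < x → All (_< p) S → All (Triggers x) S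
  large-triggers px S<p = All.map (λ qp → inj₂ (qp , px)) S<p

  small-push-allowed : ∀ {x xs S' D} (P : List ℕ) → Layout (x ∷ xs) (P ++ S') D → x < p → All (_< x) S' →
    ¬ ContainsSome T123-312 (x ∷ S' ++ D)
  small-push-allowed P g xp sx =
    No123-312⇒¬contains (layout-No123-312 (sx ∷ AllPairs-++⁻ʳ P (S↘ g)) (xp ∷ All.++⁻ʳ P (S<p g)) (D↘ g) (p≤D g))

  large-push-allowed : ∀ {x D} → AllPairs _>_ D → ¬ ContainsSome T123-312 (x ∷ D)
  large-push-allowed D↘ = No123-312⇒¬contains (No123-312-∷ (decreasing⇒No123-312 D↘)
    (λ sub bc → ⊥-elim (<-asym bc (AllPairs-pair D↘ sub))))

  record SmallStep (x : ℕ) (xs S D out : List ℕ) : Set where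
    constructor small-stepped
    field
      P S' out' : List ℕ
      S≡ : S ≡ P ++ S'
      x<P : All (x <_) P
      S'<x : All (_< x) S'
      out≡ : out ≡ P ++ out'
      next : Layout xs (x ∷ S') D
      run : RunStack T123-312 xs (x ∷ S' ++ D) out'

  small-step : ∀ {x xs S D out} → Layout (x ∷ xs) S D → x < p → RunStack T123-312 (x ∷ xs) (S ++ D) out →
    SmallStep x xs S D out
  small-step {x} {S = S} {D} g xp R with split-around x S (S↘ g) (head∉S g)
  ... | splitting P S' refl x<P S'<x
    with pops-forced P (small-triggers P x<P (All.++⁻ˡ P (S<p g))) (∈-++⁺ʳ S' (p∈D g))
           (subst (λ st → RunStack _ _ st _) (++-assoc P S' D) R)
  ...   | out' , refl , R' = small-stepped P S' out' refl x<P S'<x refl (layout-small P g xp S'<x)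
                               (push-forced (small-push-allowed P g xp S'<x) R')

  record LargeStep (x : ℕ) (xs S D out : List ℕ) : Set where
    constructor large-stepped
    field
      out' : List ℕ
      out≡ : out ≡ S ++ out'
      run : RunStack T123-312 xs (x ∷ D) out'

  large-step : ∀ {x xs S D out} → Layout (x ∷ xs) S D → p < x → RunStack T123-312 (x ∷ xs) (S ++ D) out → LargeStep x xs S D out
  large-step {S = S} g px R with pops-forced S (large-triggers px (S<p g)) (p∈D g) R
  ... | out' , refl , R' = large-stepped out' refl (push-forced (large-push-allowed (D↘ g)) R')

  record Advance (xs out : List ℕ) : Set where
    constructor advanced
    field
      S' D' Q out' : List ℕ
      out≡ : out ≡ Q ++ out'
      next : Invariant xs S' D'
      run : RunStack T123-312 xs (S' ++ D') out'

  advance : ∀ {x xs S D out} → Invariant (x ∷ xs) S D → RunStack T123-312 (x ∷ xs) (S ++ D) out → Advance xs out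
  advance I R with small⊎large (shape I)
  ... | inj₁ xp with small-step (shape I) xp R
  ...   | small-stepped P S' out' refl _ _ refl g' R' = advanced _ _ P out' refl (invariant-small I g') R'
  advance {S = S} I R | inj₂ px with large-step (shape I) px R
  ... | large-stepped out' refl R' =
    advanced [] _ S out' refl (invariant-large I px) R'

  stacked-precedes-later-smaller : ∀ {inp S D out c d} → Invariant inp S D → RunStack T123-312 inp (S ++ D) out →
    c ∈ S → d ∈ inp → d < c → (c ∷ d ∷ []) ⊆ out
  stacked-precedes-later-smaller {[]} I R cS () dc
  stacked-precedes-later-smaller {x ∷ xs} I R cS dI dc with small⊎large (shape I)
  ... | inj₁ xp with small-step (shape I) xp R
  ...   | small-stepped P S' out' refl _ S'<x refl g' R' with ∈-++⁻ P cS
  ...     | inj₁ cP = ∈-∷-⊆-++ P cP (from∈ (∈-output-pushed R' dI))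
  ...     | inj₂ cS' with dI
  ...       | here refl = ⊥-elim (<-asym dc (All.lookup S'<x cS'))
  ...       | there dI' = ++⁺ˡ P (stacked-precedes-later-smaller (invariant-small I g') R' (there cS') dI' dc)
  stacked-precedes-later-smaller {x ∷ xs} {S} I R cS dI dc | inj₂ px with large-step (shape I) px R
  ... | large-stepped out' refl R' = ∈-∷-⊆-++ S cS (from∈ (∈-output-pushed R' dI))

  small-inversion-persists : ∀ {inp S D out c d} → Invariant inp S D → RunStack T123-312 inp (S ++ D) out →
    (c ∷ d ∷ []) ⊆ inp → d < c → c < p → (c ∷ d ∷ []) ⊆ out
  small-inversion-persists {x ∷ xs} I R (refl ∷ sub) dc cp with small-step (shape I) cp R
  ... | small-stepped P S' out' refl _ _ refl g' R' =
    ++⁺ˡ P (stacked-precedes-later-smaller (invariant-small I g') R' (here refl) (to∈ sub) dc)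
  small-inversion-persists {x ∷ xs} I R (_ ∷ʳ sub) dc cp with advance I R
  ... | advanced _ _ Q out' refl I' R' = ++⁺ˡ Q (small-inversion-persists I' R' sub dc cp)

  stacked-precedes-inversion-after-large : ∀ {inp S D out a B c d} → Invariant inp S D → RunStack T123-312 inp (S ++ D) out →
    a ∈ S → (B ∷ c ∷ d ∷ []) ⊆ inp → p < B → d < c → c < p → (a ∷ c ∷ d ∷ []) ⊆ out
  stacked-precedes-inversion-after-large {[]} I R aS () pB dc cp
  stacked-precedes-inversion-after-large {x ∷ xs} I R aS sub pB dc cp with small⊎large (shape I)
  ... | inj₁ xp with small-step (shape I) xp R
  ...   | small-stepped P S' out' refl _ _ refl g' R' with ∈-++⁻ P aS
  ...     | inj₁ aP =
    ∈-∷-⊆-++ P aP (small-inversion-persists (invariant-small I g') R' (∷ˡ⁻ (⊆-skip-smaller (<-trans xp pB) sub)) dc cp)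
  ...     | inj₂ aS' =
    ++⁺ˡ P (stacked-precedes-inversion-after-large (invariant-small I g') R' (there aS') (⊆-skip-smaller (<-trans xp pB) sub) pB dc cp)
  stacked-precedes-inversion-after-large {x ∷ xs} {S} I R aS sub pB dc cp | inj₂ px with large-step (shape I) px R
  ... | large-stepped out' refl R' = ∈-∷-⊆-++ S aS (small-inversion-persists (invariant-large I px) R' (drop-large sub) dc cp)
    where
    drop-large : ∀ {B c d} → (B ∷ c ∷ d ∷ []) ⊆ x ∷ xs → (c ∷ d ∷ []) ⊆ xs
    drop-large (refl ∷ s) = s
    drop-large (_ ∷ʳ s) = ∷ˡ⁻ s

  small-precedes-inversion-after-large : ∀ {inp S D out a B c d} → Invariant inp S D → RunStack T123-312 inp (S ++ D) out →
    (a ∷ B ∷ c ∷ d ∷ []) ⊆ inp → a < p → p < B → d < c → c < p → (a ∷ c ∷ d ∷ []) ⊆ out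
  small-precedes-inversion-after-large {x ∷ xs} I R (refl ∷ sub) ap pB dc cp with small-step (shape I) ap R
  ... | small-stepped P S' out' refl _ _ refl g' R' =
    ++⁺ˡ P (stacked-precedes-inversion-after-large (invariant-small I g') R' (here refl) sub pB dc cp)
  small-precedes-inversion-after-large {x ∷ xs} I R (_ ∷ʳ sub) ap pB dc cp with advance I R
  ... | advanced _ _ Q out' refl I' R' = ++⁺ˡ Q (small-precedes-inversion-after-large I' R' sub ap pB dc cp)

  -- While only entries below p arrive, a stacked entry m ≤ u < c can only be popped by an even
  -- smaller entry, so some entry ≤ u is still stacked when c arrives, and c leaves before it.
  stacked-below-follows : ∀ (γ : List ℕ) {c δ S D out m u} → Invariant (γ ++ c ∷ δ) S D →
    RunStack T123-312 (γ ++ c ∷ δ) (S ++ D) out → All (_< p) γ → m ∈ S → m ≤ u → u < c → c < p →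
    ∃ λ m' → m' ≤ u × (c ∷ m' ∷ []) ⊆ out
  stacked-below-follows [] {D = D} I R γ<p mS mu uc cp with small-step (shape I) cp R
  ... | small-stepped P S' out' refl c<P _ refl _ R' with ∈-++⁻ P mS
  ...   | inj₁ mP = ⊥-elim (<⇒≱ (All.lookup c<P mP) (≤-trans mu (<⇒≤ uc)))
  ...   | inj₂ mS' = _ , mu , ++⁺ˡ P (⊆-trans (refl ∷ from∈ (∈-++⁺ˡ mS')) (stack⊆output R'))
  stacked-below-follows (x ∷ γ) I R (xp ∷ γ<p) mS mu uc cp with small-step (shape I) xp R
  ... | small-stepped P S' out' refl x<P _ refl g' R' with ∈-++⁻ P mS
  ...   | inj₁ mP with stacked-below-follows γ (invariant-small I g') R' γ<p (here refl)
                         (<⇒≤ (<-≤-trans (All.lookup x<P mP) mu)) uc cp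
  ...     | m' , m'u , s = m' , m'u , ++⁺ˡ P s
  stacked-below-follows (x ∷ γ) I R (xp ∷ γ<p) mS mu uc cp | small-stepped P S' out' refl x<P _ refl g' R' | inj₂ mS'
    with stacked-below-follows γ (invariant-small I g') R' γ<p (there mS') mu uc cp
  ... | m' , m'u , s = m' , m'u , ++⁺ˡ P s

  below-follows : ∀ (β : List ℕ) {b γ c δ S D out} → Invariant (β ++ b ∷ γ ++ c ∷ δ) S D →
    RunStack T123-312 (β ++ b ∷ γ ++ c ∷ δ) (S ++ D) out → All (_< p) γ → b < c → c < p →
    ∃ λ m' → m' ≤ b × (c ∷ m' ∷ []) ⊆ out
  below-follows [] {γ = γ} I R γ<p bc cp with small-step (shape I) (<-trans bc cp) R
  ... | small-stepped P S' out' refl _ _ refl g' R' with stacked-below-follows γ (invariant-small I g') R' γ<p (here refl) ≤-refl bc cp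
  ...   | m' , m'b , s = m' , m'b , ++⁺ˡ P s
  below-follows (x ∷ β) I R γ<p bc cp with advance I R
  ... | advanced _ _ Q out' refl I' R' with below-follows β I' R' γ<p bc cp
  ...   | m' , m'b , s = m' , m'b , ++⁺ˡ Q s

  stacked-precedes-below-follows : ∀ (β : List ℕ) {a b γ c δ S D out} → Invariant (β ++ b ∷ γ ++ c ∷ δ) S D →
    RunStack T123-312 (β ++ b ∷ γ ++ c ∷ δ) (S ++ D) out →
    a ∈ S → All (_< p) γ → b < a → a < c → c < p → ∃ λ m' → m' ≤ b × (a ∷ c ∷ m' ∷ []) ⊆ out
  stacked-precedes-below-follows [] {γ = γ} I R aS γ<p ba ac cp with small-step (shape I) (<-trans ba (<-trans ac cp)) R
  ... | small-stepped P S' out' refl _ S'<b refl g' R' with ∈-++⁻ P aS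
  ...   | inj₂ aS' = ⊥-elim (<-asym ba (All.lookup S'<b aS'))
  ...   | inj₁ aP with stacked-below-follows γ (invariant-small I g') R' γ<p (here refl) ≤-refl (<-trans ba ac) cp
  ...     | m' , m'b , s = m' , m'b , ∈-∷-⊆-++ P aP s
  stacked-precedes-below-follows (x ∷ β) I R aS γ<p ba ac cp with small⊎large (shape I)
  ... | inj₁ xp with small-step (shape I) xp R
  ...   | small-stepped P S' out' refl _ _ refl g' R' with ∈-++⁻ P aS
  ...     | inj₁ aP with below-follows β (invariant-small I g') R' γ<p (<-trans ba ac) cp
  ...       | m' , m'b , s = m' , m'b , ∈-∷-⊆-++ P aP s
  stacked-precedes-below-follows (x ∷ β) I R aS γ<p ba ac cp | inj₁ xp | small-stepped P S' out' refl _ _ refl g' R' | inj₂ aS'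
    with stacked-precedes-below-follows β (invariant-small I g') R' (there aS') γ<p ba ac cp
  ... | m' , m'b , s = m' , m'b , ++⁺ˡ P s
  stacked-precedes-below-follows (x ∷ β) {S = S} I R aS γ<p ba ac cp | inj₂ px with large-step (shape I) px R
  ... | large-stepped out' refl R' with below-follows β (invariant-large I px) R' γ<p (<-trans ba ac) cp
  ...   | m' , m'b , s = m' , m'b , ∈-∷-⊆-++ S aS s

  precedes-below-follows : ∀ (α : List ℕ) {a β b γ c δ S D out} → Invariant (α ++ a ∷ β ++ b ∷ γ ++ c ∷ δ) S D →
    RunStack T123-312 (α ++ a ∷ β ++ b ∷ γ ++ c ∷ δ) (S ++ D) out →
    All (_< p) γ → b < a → a < c → c < p → ∃ λ m' → m' ≤ b × (a ∷ c ∷ m' ∷ []) ⊆ out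
  precedes-below-follows [] {β = β} I R γ<p ba ac cp with small-step (shape I) (<-trans ac cp) R
  ... | small-stepped P S' out' refl _ _ refl g' R' with stacked-precedes-below-follows β (invariant-small I g') R' (here refl) γ<p ba ac cp
  ...   | m' , m'b , s = m' , m'b , ++⁺ˡ P s
  precedes-below-follows (x ∷ α) I R γ<p ba ac cp with advance I R
  ... | advanced _ _ Q out' refl I' R' with precedes-below-follows α I' R' γ<p ba ac cp
  ...   | m' , m'b , s = m' , m'b , ++⁺ˡ Q s

  D-pair-over-p : ∀ {D b} → AllPairs _>_ D → b ∈ D → p ∈ D → p < b → (b ∷ p ∷ []) ⊆ D
  D-pair-over-p (_ ∷ _) (here refl) (here refl) pb = ⊥-elim (<-irrefl refl pb)
  D-pair-over-p (_ ∷ _) (here refl) (there p∈D) pb = refl ∷ from∈ p∈D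
  D-pair-over-p (b>D ∷ _) (there bD) (here refl) pb = ⊥-elim (<-asym pb (All.lookup b>D bD))
  D-pair-over-p (_ ∷ D↘) (there bD) (there p∈D) pb = _ ∷ʳ D-pair-over-p D↘ bD p∈D pb

  Pending132 : List ℕ → List ℕ → Set
  Pending132 inp D = (∃ λ b → ∃ λ c → b ∈ D × c ∈ inp × p < c × c < b)
                   ⊎ (∃ λ b → ∃ λ c → (b ∷ c ∷ []) ⊆ inp × p < c × c < b)

  Output231OverP : List ℕ → Set
  Output231OverP out = ∃ λ b → ∃ λ c → p < c × c < b × (c ∷ b ∷ p ∷ []) ⊆ out

  Output231OverP-++ : ∀ {out} (Q : List ℕ) → Output231OverP out → Output231OverP (Q ++ out)
  Output231OverP-++ Q (b , c , pc , cb , s) = b , c , pc , cb , ++⁺ˡ Q s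

  pending132⇒231 : ∀ {inp S D out} → Layout inp S D → RunStack T123-312 inp (S ++ D) out → Pending132 inp D → Output231OverP out
  pending132⇒231 {[]} g R (inj₁ (_ , _ , _ , () , _))
  pending132⇒231 {[]} g R (inj₂ (_ , _ , () , _))
  pending132⇒231 {x ∷ xs} {D = D} g R pending with small⊎large g
  ... | inj₁ xp with small-step g xp R
  ...   | small-stepped P S' out' refl _ _ refl g' R' = Output231OverP-++ P (pending132⇒231 g' R' (still-pending pending))
    where
    still-pending : Pending132 (x ∷ xs) D → Pending132 xs D
    still-pending (inj₁ (b , c , bD , here refl , pc , cb)) = ⊥-elim (<-asym xp pc)
    still-pending (inj₁ (b , c , bD , there cI , pc , cb)) = inj₁ (b , c , bD , cI , pc , cb)
    still-pending (inj₂ (b , c , refl ∷ s , pc , cb)) = ⊥-elim (<-asym xp (<-trans pc cb))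
    still-pending (inj₂ (b , c , _ ∷ʳ s , pc , cb)) = inj₂ (b , c , s , pc , cb)
  pending132⇒231 {x ∷ xs} {S} {D} g R pending | inj₂ px with large-step g px R
  ... | large-stepped out' refl R' with Any.any? (x <?_) D
  ...   | yes x<D with find x<D
  ...     | b , bD , xb = Output231OverP-++ S (b , x , px , xb ,
                            ⊆-trans (refl ∷ D-pair-over-p (D↘ g) bD (p∈D g) (<-trans px xb)) (stack⊆output R'))
  pending132⇒231 {x ∷ xs} {S} {D} g R pending | inj₂ px | large-stepped out' refl R' | no x≮D =
    Output231OverP-++ S (pending132⇒231 (layout-large g px D<x) R' (still-pending pending))
    where
    D<x : All (_< x) D
    D<x = ∉∧¬>⇒All< (λ x∈D → All.lookup (D-fresh g) x∈D (here refl)) x≮D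
    still-pending : Pending132 (x ∷ xs) D → Pending132 xs (x ∷ D)
    still-pending (inj₁ (b , c , bD , here refl , pc , cb)) = ⊥-elim (<-asym cb (All.lookup D<x bD))
    still-pending (inj₁ (b , c , bD , there cI , pc , cb)) = inj₁ (b , c , there bD , cI , pc , cb)
    still-pending (inj₂ (b , c , refl ∷ s , pc , cb)) = inj₁ (b , c , here refl , to∈ s , pc , cb)
    still-pending (inj₂ (b , c , _ ∷ʳ s , pc , cb)) = inj₂ (b , c , s , pc , cb)

  BelowUntilLarge : ℕ → List ℕ → Set
  BelowUntilLarge t [] = ⊤
  BelowUntilLarge t (y ∷ ys) = p < y ⊎ (y < t × BelowUntilLarge t ys)

  -- For the entries L after t: p t B z w is never a 42531, and after any x < t every entry before
  -- the next one above p lies below t (so no 4213 p t x c lacks its 5).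
  No42531From : ℕ → List ℕ → Set
  No42531From t L = ∀ {B z w} → (B ∷ z ∷ w ∷ []) ⊆ L → p < B → t < z → z < p → w < t → ⊥

  No4213From : ℕ → List ℕ → Set
  No4213From t L = ∀ (α : List ℕ) {x β} → L ≡ α ++ x ∷ β → x < t → BelowUntilLarge t β

  Tame : ℕ → List ℕ → Set
  Tame t L = No42531From t L × No4213From t L

  Tame-tail : ∀ {t x xs} → Tame t (x ∷ xs) → Tame t xs
  Tame-tail (no42531 , no4213) = (λ s → no42531 (_ ∷ʳ s)) , (λ α eq xt → no4213 (_ ∷ α) (cong (_ ∷_) eq) xt)

  AllTame : List ℕ → Set
  AllTame L = ∀ (α : List ℕ) {x xs} → L ≡ α ++ x ∷ xs → Tame x xs

  AllTame-tail : ∀ {x xs} → AllTame (x ∷ xs) → AllTame xs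
  AllTame-tail tame α eq = tame (_ ∷ α) (cong (_ ∷_) eq)

  NoSmall21Across : ℕ → List ℕ → Set
  NoSmall21Across t L = ∀ {z w} → (z ∷ w ∷ []) ⊆ L → t < z → z < p → w < t → ⊥

  No21Across : ℕ → List ℕ → Set
  No21Across t out = ∀ {z w} → (z ∷ w ∷ []) ⊆ out → t < z → w < t → ⊥

  OneSided : ℕ → List ℕ → Set
  OneSided t S = ∀ {z w} → z ∈ S → w ∈ S → t < z → w < t → ⊥

  -- The state of the run relative to an entry t < p that has already been output; before-large
  -- holds until the first entry above p after t is read.
  data Phase (t : ℕ) (inp S : List ℕ) : Set where
    before-large : All (_< t) S → BelowUntilLarge t inp → Phase t inp S
    after-large : NoSmall21Across t inp → OneSided t S → (∀ {w} → w ∈ S → w < t → BelowUntilLarge t inp) →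
                  (∀ {z} → z ∈ S → t < z → All (t ≤_) inp) → Phase t inp S

  record Guard (t : ℕ) (inp S : List ℕ) : Set where
    constructor guard
    field
      tame : Tame t inp
      t∉S : t ∉ S
      t∉inp : t ∉ inp
      t<p : t < p
      phase : Phase t inp S

  record Run231Free (inp S D : List ℕ) : Set where
    constructor run231Free
    field
      out : List ℕ
      run : RunStack T123-312 inp (S ++ D) out
      avoids231 : Avoids231 out
      guarded : ∀ {t} → Guard t inp S → No21Across t out

  phase-small : ∀ {t x xs S'} (P : List ℕ) → x < p → x ≢ t → No4213From t (x ∷ xs) →
    Phase t (x ∷ xs) (P ++ S') → Phase t xs (x ∷ S')
  phase-small P xp xt no4213 (before-large S<t (inj₁ px)) = ⊥-elim (<-asym xp px)
  phase-small P xp xt no4213 (before-large S<t (inj₂ (x<t , below))) = before-large (x<t ∷ All.++⁻ʳ P S<t) below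
  phase-small {t} {x} {xs} {S'} P xp xt no4213 (after-large no21 one-sided below above) with ≢⇒<⊎> xt
  ... | inj₁ x<t = after-large (λ s → no21 (_ ∷ʳ s)) one-sided' below' above'
    where
    one-sided' : OneSided t (x ∷ S')
    one-sided' (here refl) _ tz _ = <-asym x<t tz
    one-sided' (there zS) (here refl) tz wt = <⇒≱ x<t (All.lookup (above (∈-++⁺ʳ P zS) tz) (here refl))
    one-sided' (there zS) (there wS) tz wt = one-sided (∈-++⁺ʳ P zS) (∈-++⁺ʳ P wS) tz wt
    below' : ∀ {w} → w ∈ x ∷ S' → w < t → BelowUntilLarge t xs
    below' (here refl) wt = no4213 [] refl wt
    below' (there wS) wt with below (∈-++⁺ʳ P wS) wt
    ... | inj₁ px = ⊥-elim (<-asym xp px)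
    ... | inj₂ (_ , below-xs) = below-xs
    above' : ∀ {z} → z ∈ x ∷ S' → t < z → All (t ≤_) xs
    above' (here refl) tz = ⊥-elim (<-asym x<t tz)
    above' (there zS) tz = All.tail (above (∈-++⁺ʳ P zS) tz)
  ... | inj₂ t<x = after-large (λ s → no21 (_ ∷ʳ s)) one-sided' below' above'
    where
    no-lower : ∀ {w} → w ∈ S' → w < t → ⊥
    no-lower wS wt with below (∈-++⁺ʳ P wS) wt
    ... | inj₁ px = <-asym xp px
    ... | inj₂ (x<t , _) = <-asym x<t t<x
    one-sided' : OneSided t (x ∷ S')
    one-sided' (here refl) (here refl) tz wt = <-asym tz wt
    one-sided' (here refl) (there wS) tz wt = no-lower wS wt
    one-sided' (there zS) (here refl) tz wt = <-asym wt t<x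
    one-sided' (there zS) (there wS) tz wt = one-sided (∈-++⁺ʳ P zS) (∈-++⁺ʳ P wS) tz wt
    below' : ∀ {w} → w ∈ x ∷ S' → w < t → BelowUntilLarge t xs
    below' (here refl) wt = ⊥-elim (<-asym wt t<x)
    below' (there wS) wt = ⊥-elim (no-lower wS wt)
    above' : ∀ {z} → z ∈ x ∷ S' → t < z → All (t ≤_) xs
    above' (here refl) tz = All.tabulate (λ wI → ≮⇒≥ (λ wt → no21 (refl ∷ from∈ wI) t<x xp wt))
    above' (there zS) tz = All.tail (above (∈-++⁺ʳ P zS) tz)

  NoSmall21Across-large : ∀ {t x xs S} → Tame t (x ∷ xs) → p < x → Phase t (x ∷ xs) S → NoSmall21Across t xs
  NoSmall21Across-large tame px (before-large _ _) s tz zp wt = proj₁ tame (refl ∷ s) px tz zp wt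
  NoSmall21Across-large tame px (after-large no21 _ _ _) s = no21 (_ ∷ʳ s)

  final-avoids231 : ∀ {S D} → Layout [] S D → Avoids231 (S ++ D)
  final-avoids231 {S} g s yz wy with triple-split S s
  ... | inj₁ a = <-asym yz (AllPairs-pair (S↘ g) a)
  ... | inj₂ (inj₁ (yS , a)) = <-asym wy (<-≤-trans (All.lookup (S<p g) yS) (All.lookup (p≤D g) (to∈ (∷ˡ⁻ a))))
  ... | inj₂ (inj₂ a) = <-asym yz (AllPairs-pair (D↘ g) (⊆-init a))

  final-guarded : ∀ {S D t} → Layout [] S D → Guard t [] S → No21Across t (S ++ D)
  final-guarded {S} g (guard _ _ _ tp phase) s tz wt with pair-split S s | phase
  ... | inj₁ a | before-large S<t _ = <-asym tz (All.lookup S<t (to∈ a))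
  ... | inj₁ a | after-large _ one-sided _ _ = one-sided (to∈ a) (to∈ (∷ˡ⁻ a)) tz wt
  ... | inj₂ (inj₁ (zS , wD)) | _ = <-asym wt (<-≤-trans tp (All.lookup (p≤D g) wD))
  ... | inj₂ (inj₂ a) | _ = <-asym wt (<-≤-trans tp (All.lookup (p≤D g) (to∈ (∷ˡ⁻ a))))

  small-avoids231 : ∀ {x xs P S' D} → Layout (x ∷ xs) (P ++ S') D → All (x <_) P → All (_< x) S' →
    All (λ s → Tame s (x ∷ xs)) (P ++ S') → (rec : Run231Free xs (x ∷ S') D) → Avoids231 (P ++ Run231Free.out rec)
  small-avoids231 {x} {xs} {P} {S'} g x<P S'<x tameS rec s yz wy with triple-split P s
  ... | inj₁ a = <-asym yz (AllPairs-pair (AllPairs-++⁻ˡ P (S↘ g)) a)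
  ... | inj₂ (inj₂ a) = Run231Free.avoids231 rec a yz wy
  ... | inj₂ (inj₁ (yP , a)) = Run231Free.guarded rec y-guard a yz wy
    where
    x<y : x < _
    x<y = All.lookup x<P yP
    y-guard : Guard _ xs (x ∷ S')
    y-guard = guard (Tame-tail (All.lookup tameS (∈-++⁺ˡ yP)))
                (λ { (here e) → <-irrefl (sym e) x<y ; (there i) → <-asym x<y (All.lookup S'<x i) })
                (∉-tail (All.lookup (S-fresh g) (∈-++⁺ˡ yP)))
                (All.lookup (S<p g) (∈-++⁺ˡ yP))
                (before-large (x<y ∷ All.map (λ s<x → <-trans s<x x<y) S'<x) (proj₂ (All.lookup tameS (∈-++⁺ˡ yP)) [] refl x<y))

  small-guarded : ∀ {x xs P S' D t} → Layout (x ∷ xs) (P ++ S') D → x < p → (rec : Run231Free xs (x ∷ S') D) →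
    Guard t (x ∷ xs) (P ++ S') → No21Across t (P ++ Run231Free.out rec)
  small-guarded {x} {xs} {P} {S'} g xp rec (guard tame t∉S t∉inp tp phase) s tz wt with pair-split P s
  ... | inj₂ (inj₂ a) = Run231Free.guarded rec
          (guard (Tame-tail tame) (λ { (here e) → t∉inp (here e) ; (there i) → t∉S (∈-++⁺ʳ P i) })
                 (∉-tail t∉inp) tp (phase-small P xp (λ e → t∉inp (here (sym e))) (proj₂ tame) phase)) a tz wt
  ... | inj₁ a with phase
  ...   | before-large S<t _ = <-asym tz (All.lookup S<t (∈-++⁺ˡ (to∈ a)))
  ...   | after-large _ one-sided _ _ = one-sided (∈-++⁺ˡ (to∈ a)) (∈-++⁺ˡ (to∈ (∷ˡ⁻ a))) tz wt
  small-guarded {x} {xs} {P} {S'} g xp rec (guard _ _ _ tp phase) s tz wt | inj₂ (inj₁ (zP , wO)) with phase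
  ... | before-large S<t _ = <-asym tz (All.lookup S<t (∈-++⁺ˡ zP))
  ... | after-large _ one-sided _ above with ∈-++⁻ xs (output-∈ (Run231Free.run rec) wO)
  ...   | inj₁ wI = <⇒≱ wt (All.lookup (above (∈-++⁺ˡ zP) tz) (there wI))
  ...   | inj₂ (here refl) = <⇒≱ wt (All.lookup (above (∈-++⁺ˡ zP) tz) (here refl))
  ...   | inj₂ (there wSD) with ∈-++⁻ S' wSD
  ...     | inj₁ wS = one-sided (∈-++⁺ˡ zP) (∈-++⁺ʳ P wS) tz wt
  ...     | inj₂ wD = <-asym wt (<-≤-trans tp (All.lookup (p≤D g) wD))

  large-avoids231 : ∀ {x xs S D} → Layout (x ∷ xs) S D → p < x → All (λ s → Tame s (x ∷ xs)) S →
    (rec : Run231Free xs [] (x ∷ D)) → Avoids231 (S ++ Run231Free.out rec)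
  large-avoids231 {x} {xs} {S} g px tameS rec s yz wy with triple-split S s
  ... | inj₁ a = <-asym yz (AllPairs-pair (S↘ g) a)
  ... | inj₂ (inj₂ a) = Run231Free.avoids231 rec a yz wy
  ... | inj₂ (inj₁ (yS , a)) = Run231Free.guarded rec y-guard a yz wy
    where
    tame-y : Tame _ (x ∷ xs)
    tame-y = All.lookup tameS yS
    y-guard : Guard _ xs []
    y-guard = guard (Tame-tail tame-y) (λ ()) (∉-tail (All.lookup (S-fresh g) yS)) (All.lookup (S<p g) yS)
                (after-large (λ s' yz' zp wy' → proj₁ tame-y (refl ∷ s') px yz' zp wy') (λ ()) (λ ()) (λ ()))

  large-guarded : ∀ {x xs S D t} → Layout (x ∷ xs) S D → p < x → (rec : Run231Free xs [] (x ∷ D)) →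
    Guard t (x ∷ xs) S → No21Across t (S ++ Run231Free.out rec)
  large-guarded {x} {xs} {S} g px rec (guard tame t∉S t∉inp tp phase) s tz wt with pair-split S s
  ... | inj₂ (inj₂ a) = Run231Free.guarded rec
          (guard (Tame-tail tame) (λ ()) (∉-tail t∉inp) tp (after-large (NoSmall21Across-large tame px phase) (λ ()) (λ ()) (λ ())))
          a tz wt
  ... | inj₁ a with phase
  ...   | before-large S<t _ = <-asym tz (All.lookup S<t (to∈ a))
  ...   | after-large _ one-sided _ _ = one-sided (to∈ a) (to∈ (∷ˡ⁻ a)) tz wt
  large-guarded {x} {xs} {S} g px rec (guard _ _ _ tp phase) s tz wt | inj₂ (inj₁ (zS , wO)) with phase
  ... | before-large S<t _ = <-asym tz (All.lookup S<t zS)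
  ... | after-large _ _ _ above with ∈-++⁻ xs (output-∈ (Run231Free.run rec) wO)
  ...   | inj₁ wI = <⇒≱ wt (All.lookup (above zS tz) (there wI))
  ...   | inj₂ (here refl) = <-asym wt (<-trans tp px)
  ...   | inj₂ (there wD) = <-asym wt (<-≤-trans tp (All.lookup (p≤D g) wD))

  build : ∀ inp {S D} → Invariant inp S D → AllTame inp → All (λ s → Tame s inp) S → Run231Free inp S D
  build [] I _ _ = run231Free _ done (final-avoids231 (shape I)) (final-guarded (shape I))
  build (x ∷ xs) {S} {D} I tame tameS with small⊎large (shape I)
  ... | inj₁ xp with split-around x S (S↘ (shape I)) (head∉S (shape I))
  ...   | splitting P S' refl x<P S'<x =
    run231Free (P ++ Run231Free.out rec) run (small-avoids231 g x<P S'<x tameS rec) (small-guarded g xp rec)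
    where
    g : Layout (x ∷ xs) (P ++ S') D
    g = shape I
    rec : Run231Free xs (x ∷ S') D
    rec = build xs (invariant-small I (layout-small P g xp S'<x)) (AllTame-tail tame)
                (tame [] refl ∷ All.map Tame-tail (All.++⁻ʳ P tameS))
    run : RunStack T123-312 (x ∷ xs) ((P ++ S') ++ D) (P ++ Run231Free.out rec)
    run = subst (λ st → RunStack T123-312 (x ∷ xs) st (P ++ Run231Free.out rec)) (sym (++-assoc P S' D))
            (pops P (small-triggers P x<P (All.++⁻ˡ P (S<p g))) (∈-++⁺ʳ S' (p∈D g))
              (push (small-push-allowed P g xp S'<x) (Run231Free.run rec)))
  build (x ∷ xs) {S} {D} I tame tameS | inj₂ px =
    run231Free (S ++ Run231Free.out rec) run (large-avoids231 g px tameS rec) (large-guarded g px rec)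
    where
    g : Layout (x ∷ xs) S D
    g = shape I
    rec : Run231Free xs [] (x ∷ D)
    rec = build xs (invariant-large I px) (AllTame-tail tame) []
    run : RunStack T123-312 (x ∷ xs) (S ++ D) (S ++ Run231Free.out rec)
    run = pops S (large-triggers px (S<p g)) (p∈D g) (push (large-push-allowed (D↘ g)) (Run231Free.run rec))

  layout-init : ∀ {r} → Unique (p ∷ r) → Layout r [] (p ∷ [])
  layout-init U = layout [] [] ([] ∷ []) (≤-refl ∷ []) (here refl) (AllPairs.tail U) [] (Unique[x∷xs]⇒x∉xs U ∷ [])

  invariant-init : ∀ {r} → Unique (p ∷ r) → AvoidsFirst (p ∷ r) (1 ∷ 3 ∷ 2 ∷ []) → Invariant r [] (p ∷ [])
  invariant-init U a132 = invariant (layout-init U) (λ s pc cb → a132 (_ , s , iso132 pc cb)) (λ { (here refl) _ pc → pc })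

  push-first : ∀ {r mid} → RunStack T123-312 (p ∷ r) [] mid → RunStack T123-312 r (p ∷ []) mid
  push-first (push _ R) = R

  avoids231⇒avoids[132 : ∀ {r mid} → Unique (p ∷ r) → RunStack T123-312 r (p ∷ []) mid → Avoids231 mid →
    AvoidsFirst (p ∷ r) (1 ∷ 3 ∷ 2 ∷ [])
  avoids231⇒avoids[132 U R av (_ , s , cons (_ ∷ pc ∷ []) (cons (cb ∷ []) _))
    with pending132⇒231 (layout-init U) R (inj₂ (_ , _ , s , reflect< pc lit , reflect> cb lit))
  ... | b , c , pc , cb , s' = av s' cb pc

  avoids231⇒avoids[42531 : ∀ {r mid} → Unique (p ∷ r) → AvoidsFirst (p ∷ r) (1 ∷ 3 ∷ 2 ∷ []) →
    RunStack T123-312 r (p ∷ []) mid → Avoids231 mid → AvoidsFirst (p ∷ r) (4 ∷ 2 ∷ 5 ∷ 3 ∷ 1 ∷ [])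
  avoids231⇒avoids[42531 U a132 R av
    (_ , s , cons (ap ∷ pB ∷ cp ∷ _ ∷ []) (cons (_ ∷ ac ∷ da ∷ []) (cons _ (cons (dc ∷ []) _)))) =
    av (small-precedes-inversion-after-large (invariant-init U a132) R s
          (reflect> ap lit) (reflect< pB lit) (reflect> dc lit) (reflect> cp lit))
       (reflect< ac lit) (reflect> da lit)

  avoids231⇒avoids[421b53 : ∀ {r mid} → Unique (p ∷ r) → AvoidsFirst (p ∷ r) (1 ∷ 3 ∷ 2 ∷ []) →
    RunStack T123-312 r (p ∷ []) mid → Avoids231 mid → Avoids[421b53 (p ∷ r)
  avoids231⇒avoids[421b53 U a132 R av a b c s (cons (_ ∷ _ ∷ cp ∷ []) (cons (ba ∷ ac ∷ []) _)) with ⊆-split s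
  ... | α , _ , refl , s₁ with ⊆-split s₁
  ...   | β , _ , refl , s₂ with ⊆-split s₂
  ...     | γ , δ , refl , _ with Any.any? (p <?_) γ
  ...       | yes p<γ with find p<γ
  ...         | d , dγ , pd = d , ++⁺ˡ α (refl ∷ ++⁺ˡ β (refl ∷ ∈-∷-⊆-++ γ dγ (refl ∷ minimum δ))) ,
                              iso42153 (reflect> ba lit) (reflect< ac lit) (reflect> cp lit) pd
  avoids231⇒avoids[421b53 U a132 R av a b c s (cons (_ ∷ _ ∷ cp ∷ []) (cons (ba ∷ ac ∷ []) _))
    | α , _ , refl , s₁ | β , _ , refl , s₂ | γ , δ , refl , _ | no p≮γ
    with precedes-below-follows α (invariant-init U a132) R γ<p (reflect> ba lit) (reflect< ac lit) (reflect> cp lit)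
    where
    γ<p : All (_< p) γ
    γ<p = ∉∧¬>⇒All< (λ p∈γ → Unique[x∷xs]⇒x∉xs U (∈-++⁺ʳ α (there (∈-++⁺ʳ β (there (∈-++⁺ˡ p∈γ)))))) p≮γ
  ... | m , m≤b , s' = ⊥-elim (av s' (reflect< ac lit) (≤-<-trans m≤b (reflect> ba lit)))

  BelowUntilLarge-large : ∀ {x} β → p ∉ β → p < x → BelowUntilLarge x β
  BelowUntilLarge-large [] _ _ = tt
  BelowUntilLarge-large (z ∷ β) p∉ px with ≢⇒<⊎> (λ z≡p → p∉ (here (sym z≡p)))
  ... | inj₁ zp = inj₂ (<-trans zp px , BelowUntilLarge-large β (∉-tail p∉) px)
  ... | inj₂ pz = inj₁ pz

  LargeBefore : ℕ → List ℕ → Set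
  LargeBefore x L = ∀ {c} → c ∈ L → x < c → c < p → ∃ λ d → (d ∷ c ∷ []) ⊆ L × p < d

  LargeBefore⇒BelowUntilLarge : ∀ {x} L → Unique L → p ∉ L → x ∉ L → LargeBefore x L → BelowUntilLarge x L
  LargeBefore⇒BelowUntilLarge [] _ _ _ _ = tt
  LargeBefore⇒BelowUntilLarge {x} (z ∷ L) U p∉ x∉ before with ≢⇒<⊎> (λ z≡p → p∉ (here (sym z≡p)))
  ... | inj₂ p<z = inj₁ p<z
  ... | inj₁ z<p with ≢⇒<⊎> (λ z≡x → x∉ (here (sym z≡x)))
  ...   | inj₁ z<x = inj₂ (z<x , LargeBefore⇒BelowUntilLarge L (AllPairs.tail U) (∉-tail p∉) (∉-tail x∉) before')
    where
    before' : LargeBefore x L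
    before' cL xc cp with before (there cL) xc cp
    ... | d , refl ∷ _ , pd = ⊥-elim (<-asym z<p pd)
    ... | d , _ ∷ʳ s , pd = d , s , pd
  ...   | inj₂ x<z with before (here refl) x<z z<p
  ...     | d , refl ∷ _ , pd = ⊥-elim (<-asym z<p pd)
  ...     | d , _ ∷ʳ s , pd = ⊥-elim (Unique[x∷xs]⇒x∉xs U (to∈ (∷ˡ⁻ s)))

  avoids[421b53⇒No4213From : ∀ α {x xs} → Unique (p ∷ α ++ x ∷ xs) → Avoids[421b53 (p ∷ α ++ x ∷ xs) → No4213From x xs
  avoids[421b53⇒No4213From α {x} U a421b53 α' {y} {β} refl yx =
    below (≢⇒<⊎> (λ x≡p → Unique[x∷xs]⇒x∉xs U (∈-++⁺ʳ α (here (sym x≡p)))))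
    where
    p∉β : p ∉ β
    p∉β i = Unique[x∷xs]⇒x∉xs U (∈-++⁺ʳ α (there (∈-++⁺ʳ α' (there i))))
    x∉α×x∉xs : x ∉ α × x ∉ α' ++ y ∷ β
    x∉α×x∉xs = Unique-middle α (AllPairs.tail U)
    U-xs : Unique (α' ++ y ∷ β)
    U-xs = AllPairs.tail (Unique-++⁻ʳ α (AllPairs.tail U))
    y∉α'×y∉β : y ∉ α' × y ∉ β
    y∉α'×y∉β = Unique-middle α' U-xs
    before : LargeBefore x β
    before cβ xc cp with a421b53 x y _ (++⁺ˡ α (refl ∷ ++⁺ˡ α' (refl ∷ from∈ cβ))) (iso4213 yx xc cp)
    ... | d , s , cons (_ ∷ _ ∷ pd ∷ _ ∷ []) _ =
      d , ⊆-after-unique α' (proj₁ y∉α'×y∉β) (proj₂ y∉α'×y∉β) (⊆-after-unique α (proj₁ x∉α×x∉xs) (proj₂ x∉α×x∉xs) s) ,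
      reflect< pd lit
    below : x < p ⊎ p < x → BelowUntilLarge x β
    below (inj₁ _) =
      LargeBefore⇒BelowUntilLarge β (AllPairs.tail (Unique-++⁻ʳ α' U-xs)) p∉β (λ i → proj₂ x∉α×x∉xs (∈-++⁺ʳ α' (there i))) before
    below (inj₂ px) = BelowUntilLarge-large β p∉β px

  avoids⇒AllTame : ∀ {r} → Unique (p ∷ r) → AvoidsFirst (p ∷ r) (4 ∷ 2 ∷ 5 ∷ 3 ∷ 1 ∷ []) → Avoids[421b53 (p ∷ r) →
    AllTame r
  avoids⇒AllTame U a42531 a421b53 α refl =
    (λ s pB xz zp wx → a42531 (_ , ++⁺ˡ α (refl ∷ s) , iso42531 wx xz zp pB)) ,
    avoids[421b53⇒No4213From α U a421b53

sortable⇒avoids : ∀ n π → IsPerm n π → Sortable T123-312 n π →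
  AvoidsFirst π (1 ∷ 3 ∷ 2 ∷ []) × AvoidsFirst π (4 ∷ 2 ∷ 5 ∷ 3 ∷ 1 ∷ []) × Avoids[421b53 π
sortable⇒avoids n [] _ _ = (λ ()) , (λ ()) , tt
sortable⇒avoids n (p ∷ r) perm (mid , R , R₂₁) =
  a132 , avoids231⇒avoids[42531 U a132 R' av , avoids231⇒avoids[421b53 U a132 R' av
  where
  open FirstEntry p
  U : Unique (p ∷ r)
  U = IsPerm⇒Unique perm
  R' : RunStack T123-312 r (p ∷ []) mid
  R' = push-first R
  av : Avoids231 mid
  av = sortable⇒avoids231 R₂₁
  a132 : AvoidsFirst (p ∷ r) (1 ∷ 3 ∷ 2 ∷ [])
  a132 = avoids231⇒avoids[132 U R' av

avoids⇒sortable : ∀ n π → IsPerm n π →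
  AvoidsFirst π (1 ∷ 3 ∷ 2 ∷ []) × AvoidsFirst π (4 ∷ 2 ∷ 5 ∷ 3 ∷ 1 ∷ []) × Avoids[421b53 π → Sortable T123-312 n π
avoids⇒sortable zero [] _ _ = [] , done , done
avoids⇒sortable (suc n) [] perm _ with ↭-length perm
... | ()
avoids⇒sortable n (p ∷ r) perm (a132 , a42531 , a421b53) =
  Run231Free.out B , R , avoids231⇒sortable mid↭ (Run231Free.avoids231 B)
  where
  open FirstEntry p
  B : Run231Free r [] (p ∷ [])
  B = build r (invariant-init (IsPerm⇒Unique perm) a132) (avoids⇒AllTame (IsPerm⇒Unique perm) a42531 a421b53) []
  R : RunStack T123-312 (p ∷ r) [] (Run231Free.out B)
  R = push (No123-312⇒¬contains No123-312-[x]) (Run231Free.run B)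
  mid↭ : Run231Free.out B ↭ applyUpTo suc n
  mid↭ = ↭-trans (output↭ R) (↭-trans (↭-reflexive (++-identityʳ (p ∷ r))) perm)

mainTheorem12 : (n : ℕ) (π : List ℕ) → IsPerm n π →
    Sortable T123-312 n π ⇔
      (AvoidsFirst π (1 ∷ 3 ∷ 2 ∷ []) × AvoidsFirst π (4 ∷ 2 ∷ 5 ∷ 3 ∷ 1 ∷ []) × Avoids[421b53 π)
mainTheorem12 n π perm = mk⇔ (sortable⇒avoids n π perm) (avoids⇒sortable n π perm)
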